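{- Let $\mathrm{Op}$ be a subset of the operations and constants of $\mathbf{ACT}_\omega$ (namely of $\backslash,/,\cdot,\wedge,\vee,{}^*,\top,\bot,\mathbf 1$) containing the product $\cdot$, and let $\mathcal L$ be the elementary fragment obtained by restricting formulae to those built from variables using only operations in $\mathrm{Op}$, and keeping only the axioms and rules of $\mathbf{ACT}_\omega$ that involve these operations, plus the identity axiom and Cut. Then for every set $\mathcal H$ of sequents and every sequent $\Pi\to C$ in this restricted language, $\mathcal H\vdash_{\mathcal L}\Pi\to C$ if and only if $\mathcal H\vdash_{\mathbf{ACT}_\omega}\Pi\to C$. The same holds with $\mathbf{ACT}^+_\omega$ (operations $\backslash,/,\cdot,\wedge,\vee,{}^+,\top,\bot$) in place of $\mathbf{ACT}_\omega$.
   Context: $\mathbf{ACT}_\omega$: sequents $A_1,\dots,A_n\to B$, $n\ge0$; axioms and rules: $A\to A$; $\Gamma,\bot,\Delta\to C$; $\Pi\to\top$; $\to\mathbf 1$; from $\Gamma,\Delta\to C$ infer $\Gamma,\mathbf 1,\Delta\to C$; from $\Gamma,A,B,\Delta\to C$ infer $\Gamma,A\cdot B,\Delta\to C$; from $\Gamma\to A$, $\Delta\to B$ infer $\Gamma,\Delta\to A\cdot B$; from $\Pi\to A$ and $\Gamma,B,\Delta\to C$ infer $\Gamma,\Pi,A\backslash B,\Delta\to C$ and $\Gamma,B/A,\Pi,\Delta\to C$; from $A,\Pi\to B$ infer $\Pi\to A\backslash B$; from $\Pi,A\to B$ infer $\Pi\to B/A$; from $\Gamma,A,\Delta\to C$ (or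 $\Gamma,B,\Delta\to C$) infer $\Gamma,A\wedge B,\Delta\to C$; from $\Pi\to A$, $\Pi\to B$ infer $\Pi\to A\wedge B$; from $\Gamma,A,\Delta\to C$ and $\Gamma,B,\Delta\to C$ infer $\Gamma,A\vee B,\Delta\to C$; from $\Pi\to A$ (or $\Pi\to B$) infer $\Pi\to A\vee B$; Cut: from $\Pi\to A$ and $\Gamma,A,\Delta\to C$ infer $\Gamma,\Pi,\Delta\to C$; from $\Gamma,A^n,\Delta\to C$ for all $n\ge0$ infer $\Gamma,A^*,\Delta\to C$; for $n\ge0$ from $\Pi_1\to A,\dots,\Pi_n\to A$ infer $\Pi_1,\dots,\Pi_n\to A^*$. $\mathbf{ACT}^+_\omega$: no $\mathbf 1$; sequents must have $n\ge1$ (also in hypotheses); right rules for $\backslash,/$ require $\Pi$ non-empty; $^+$ instead of $^*$ with rules: from $\Gamma,A^n,\Delta\to C$ for all $n\ge1$ infer $\Gamma,A^+,\Delta\to C$; for $n\ge1$ from $\Pi_1\to A,\dots,\Pi_n\to A$ infer $\Pi_1,\dots,\Pi_n\to A^+$. Derivations may be infinite but well-founded; $\mathcal H\vdash$ means derivability with $\mathcal H$ as extra axioms. -}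

module Defs where

open import Data.Nat using (ℕ; suc)
open import Data.Bool using (Bool; true; false; T)
open import Data.List using (List; []; _∷_; _++_; replicate; concat; length; map; lookup)
open import Data.Fin using (Fin)
open import Data.Product using (Σ; _×_)
open import Relation.Binary.PropositionalEquality using (_≡_)
open import Relation.Nullary using (¬_)

data Con : Set where
  c\ c/ c· c∧ c∨ c* c+ c⊤ c⊥ c1 : Con

OpSet : Set
OpSet = Con → Bool

_⊆ᵒ_ : OpSet → OpSet → Set
S ⊆ᵒ S' = ∀ c → T (S c) → T (S' c)

opsω : OpSet
opsω c+ = false
opsω _  = true

ops⁺ : OpSet
ops⁺ c* = false
ops⁺ c1 = false
ops⁺ _  = true

data Fm (S : OpSet) : Set where
  var   : ℕ → Fm S
  under : T (S c\) → Fm S → Fm S → Fm S   -- under p A B  =  A \ B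
  over  : T (S c/) → Fm S → Fm S → Fm S   -- over  p B A  =  B / A
  prod  : T (S c·) → Fm S → Fm S → Fm S
  meet  : T (S c∧) → Fm S → Fm S → Fm S
  join  : T (S c∨) → Fm S → Fm S → Fm S
  star  : T (S c*) → Fm S → Fm S
  plus  : T (S c+) → Fm S → Fm S
  top   : T (S c⊤) → Fm S
  bot   : T (S c⊥) → Fm S
  one   : T (S c1) → Fm S

infix 4 _⇒_
data Seq (S : OpSet) : Set where
  _⇒_ : List (Fm S) → Fm S → Seq S

emb : ∀ {S S'} → S ⊆ᵒ S' → Fm S → Fm S'
emb i (var x)      = var x
emb i (under p A B) = under (i c\ p) (emb i A) (emb i B)
emb i (over p B A) = over (i c/ p) (emb i B) (emb i A)
emb i (prod p A B) = prod (i c· p) (emb i A) (emb i B)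
emb i (meet p A B) = meet (i c∧ p) (emb i A) (emb i B)
emb i (join p A B) = join (i c∨ p) (emb i A) (emb i B)
emb i (star p A)   = star (i c* p) (emb i A)
emb i (plus p A)   = plus (i c+ p) (emb i A)
emb i (top p)      = top (i c⊤ p)
emb i (bot p)      = bot (i c⊥ p)
emb i (one p)      = one (i c1 p)

embSeq : ∀ {S S'} → S ⊆ᵒ S' → Seq S → Seq S'
embSeq i (Π ⇒ C) = map (emb i) Π ⇒ emb i C

Img : ∀ {S S'} → S ⊆ᵒ S' → (Seq S → Set) → Seq S' → Set
Img {S} i H s = Σ (Seq S) (λ h → H h × embSeq i h ≡ s)

-- Instantiated at S = opsω it is ACT_ω; at a sub-language S it is the
-- elementary fragment (only rules for connectives present in S, plus
-- identity and Cut).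

infix 3 _⊢ω_
data _⊢ω_ {S : OpSet} (H : Seq S → Set) : Seq S → Set where
  hyp  : ∀ {s} → H s → H ⊢ω s
  ax   : ∀ {A} → H ⊢ω (A ∷ [] ⇒ A)
  ⊥L   : ∀ {p Γ Δ C} → H ⊢ω (Γ ++ bot p ∷ Δ ⇒ C)
  ⊤R   : ∀ {p Π} → H ⊢ω (Π ⇒ top p)
  1R   : ∀ {p} → H ⊢ω ([] ⇒ one p)
  1L   : ∀ {p Γ Δ C} → H ⊢ω (Γ ++ Δ ⇒ C) → H ⊢ω (Γ ++ one p ∷ Δ ⇒ C)
  ·L   : ∀ {p Γ A B Δ C} → H ⊢ω (Γ ++ A ∷ B ∷ Δ ⇒ C)
         → H ⊢ω (Γ ++ prod p A B ∷ Δ ⇒ C)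
  ·R   : ∀ {p Γ Δ A B} → H ⊢ω (Γ ⇒ A) → H ⊢ω (Δ ⇒ B)
         → H ⊢ω (Γ ++ Δ ⇒ prod p A B)
  under-L   : ∀ {p Π A Γ B Δ C} → H ⊢ω (Π ⇒ A) → H ⊢ω (Γ ++ B ∷ Δ ⇒ C)
         → H ⊢ω (Γ ++ Π ++ under p A B ∷ Δ ⇒ C)
  over-L   : ∀ {p Π A Γ B Δ C} → H ⊢ω (Π ⇒ A) → H ⊢ω (Γ ++ B ∷ Δ ⇒ C)
         → H ⊢ω (Γ ++ over p B A ∷ Π ++ Δ ⇒ C)
  under-R   : ∀ {p A Π B} → H ⊢ω (A ∷ Π ⇒ B) → H ⊢ω (Π ⇒ under p A B)
  over-R   : ∀ {p A Π B} → H ⊢ω (Π ++ A ∷ [] ⇒ B) → H ⊢ω (Π ⇒ over p B A)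
  ∧L₁  : ∀ {p Γ A B Δ C} → H ⊢ω (Γ ++ A ∷ Δ ⇒ C) → H ⊢ω (Γ ++ meet p A B ∷ Δ ⇒ C)
  ∧L₂  : ∀ {p Γ A B Δ C} → H ⊢ω (Γ ++ B ∷ Δ ⇒ C) → H ⊢ω (Γ ++ meet p A B ∷ Δ ⇒ C)
  ∧R   : ∀ {p Π A B} → H ⊢ω (Π ⇒ A) → H ⊢ω (Π ⇒ B) → H ⊢ω (Π ⇒ meet p A B)
  ∨L   : ∀ {p Γ A B Δ C} → H ⊢ω (Γ ++ A ∷ Δ ⇒ C) → H ⊢ω (Γ ++ B ∷ Δ ⇒ C)
         → H ⊢ω (Γ ++ join p A B ∷ Δ ⇒ C)
  ∨R₁  : ∀ {p Π A B} → H ⊢ω (Π ⇒ A) → H ⊢ω (Π ⇒ join p A B)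
  ∨R₂  : ∀ {p Π A B} → H ⊢ω (Π ⇒ B) → H ⊢ω (Π ⇒ join p A B)
  cut  : ∀ {Π A Γ Δ C} → H ⊢ω (Π ⇒ A) → H ⊢ω (Γ ++ A ∷ Δ ⇒ C)
         → H ⊢ω (Γ ++ Π ++ Δ ⇒ C)
  *L   : ∀ {p Γ A Δ C} → ((n : ℕ) → H ⊢ω (Γ ++ replicate n A ++ Δ ⇒ C))
         → H ⊢ω (Γ ++ star p A ∷ Δ ⇒ C)
  *R   : ∀ {p A} (Πs : List (List (Fm S)))
         → ((i : Fin (length Πs)) → H ⊢ω (lookup Πs i ⇒ A))
         → H ⊢ω (concat Πs ⇒ star p A)

-- ACT⁺_ω calculus: no 1, antecedents non-empty (the axioms ax, ⊥L,
-- hypotheses (assumed non-empty) and ⊤R (explicitly) have non-empty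
-- antecedents, and all rules preserve this), right rules for \ and /
-- require non-empty Π, and ⁺ instead of *.

NonEmpty : ∀ {S} → List (Fm S) → Set
NonEmpty Π = ¬ (Π ≡ [])

infix 3 _⊢⁺_
data _⊢⁺_ {S : OpSet} (H : Seq S → Set) : Seq S → Set where
  hyp  : ∀ {s} → H s → H ⊢⁺ s
  ax   : ∀ {A} → H ⊢⁺ (A ∷ [] ⇒ A)
  ⊥L   : ∀ {p Γ Δ C} → H ⊢⁺ (Γ ++ bot p ∷ Δ ⇒ C)
  ⊤R   : ∀ {p Π} → NonEmpty Π → H ⊢⁺ (Π ⇒ top p)
  ·L   : ∀ {p Γ A B Δ C} → H ⊢⁺ (Γ ++ A ∷ B ∷ Δ ⇒ C)
         → H ⊢⁺ (Γ ++ prod p A B ∷ Δ ⇒ C)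
  ·R   : ∀ {p Γ Δ A B} → H ⊢⁺ (Γ ⇒ A) → H ⊢⁺ (Δ ⇒ B)
         → H ⊢⁺ (Γ ++ Δ ⇒ prod p A B)
  under-L   : ∀ {p Π A Γ B Δ C} → H ⊢⁺ (Π ⇒ A) → H ⊢⁺ (Γ ++ B ∷ Δ ⇒ C)
         → H ⊢⁺ (Γ ++ Π ++ under p A B ∷ Δ ⇒ C)
  over-L   : ∀ {p Π A Γ B Δ C} → H ⊢⁺ (Π ⇒ A) → H ⊢⁺ (Γ ++ B ∷ Δ ⇒ C)
         → H ⊢⁺ (Γ ++ over p B A ∷ Π ++ Δ ⇒ C)
  under-R   : ∀ {p A Π B} → NonEmpty Π → H ⊢⁺ (A ∷ Π ⇒ B) → H ⊢⁺ (Π ⇒ under p A B)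
  over-R   : ∀ {p A Π B} → NonEmpty Π → H ⊢⁺ (Π ++ A ∷ [] ⇒ B) → H ⊢⁺ (Π ⇒ over p B A)
  ∧L₁  : ∀ {p Γ A B Δ C} → H ⊢⁺ (Γ ++ A ∷ Δ ⇒ C) → H ⊢⁺ (Γ ++ meet p A B ∷ Δ ⇒ C)
  ∧L₂  : ∀ {p Γ A B Δ C} → H ⊢⁺ (Γ ++ B ∷ Δ ⇒ C) → H ⊢⁺ (Γ ++ meet p A B ∷ Δ ⇒ C)
  ∧R   : ∀ {p Π A B} → H ⊢⁺ (Π ⇒ A) → H ⊢⁺ (Π ⇒ B) → H ⊢⁺ (Π ⇒ meet p A B)
  ∨L   : ∀ {p Γ A B Δ C} → H ⊢⁺ (Γ ++ A ∷ Δ ⇒ C) → H ⊢⁺ (Γ ++ B ∷ Δ ⇒ C)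
         → H ⊢⁺ (Γ ++ join p A B ∷ Δ ⇒ C)
  ∨R₁  : ∀ {p Π A B} → H ⊢⁺ (Π ⇒ A) → H ⊢⁺ (Π ⇒ join p A B)
  ∨R₂  : ∀ {p Π A B} → H ⊢⁺ (Π ⇒ B) → H ⊢⁺ (Π ⇒ join p A B)
  cut  : ∀ {Π A Γ Δ C} → H ⊢⁺ (Π ⇒ A) → H ⊢⁺ (Γ ++ A ∷ Δ ⇒ C)
         → H ⊢⁺ (Γ ++ Π ++ Δ ⇒ C)
  +L   : ∀ {p Γ A Δ C} → ((n : ℕ) → H ⊢⁺ (Γ ++ replicate (suc n) A ++ Δ ⇒ C))
         → H ⊢⁺ (Γ ++ plus p A ∷ Δ ⇒ C)
  +R   : ∀ {p A} (Πs : List (List (Fm S))) → ¬ (Πs ≡ [])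
         → ((i : Fin (length Πs)) → H ⊢⁺ (lookup Πs i ⇒ A))
         → H ⊢⁺ (concat Πs ⇒ plus p A)

{-# OPTIONS --safe #-}
module Submission where

-- Conservativity is proved semantically, in a canonical model built from derivability in the
-- fragment. A formula of the large language denotes a set ⟦ C ⟧ of contexts of the fragment:
-- residuals, meet and ⊤ are read off concatenation of contexts, while product, join, iteration,
-- ⊥ and 1 denote the closure Cl X of the evident set X, where Γ ∈ Cl X when Γ may replace every
-- member of X in any derivable sequent Φ, _, Ψ → D. Every rule of the large calculus preserves
-- validity (Π ⊨ C: each context satisfying Π lies in ⟦ C ⟧), and on embedded formulae of the
-- fragment ⟦ C ⟧ is exactly the set of admissible contexts deriving C (truth lemma), so embedded hypotheses
-- are valid. As the antecedent Π satisfies its own embedding, validity of the embedded sequent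
-- gives Π → C in the fragment.

open import Defs
open import Data.Bool using (T)
open import Data.Empty using (⊥; ⊥-elim)
open import Data.Fin using (zero; suc)
open import Data.List using (List; []; _∷_; _++_; replicate; concat; length; map; lookup)
open import Data.List.Properties using (++-assoc; ++-identityʳ; map-++; map-replicate; concat-map)
open import Data.Nat using (ℕ; zero; suc)
open import Data.Product using (Σ; ∃; _×_; _,_; proj₁; proj₂)
open import Data.Sum using (_⊎_; inj₁; inj₂)
open import Data.Unit using (⊤; tt)
open import Function.Base using (_∘_)
open import Function.Bundles using (_⇔_; mk⇔)
open import Level using (Level)
open import Relation.Binary.PropositionalEquality
  using (_≡_; _≢_; refl; sym; trans; cong; subst; module ≡-Reasoning)
open import Relation.Nullary using (¬_)

private
  variable
    ℓ₁ ℓ₂ ℓ₃ : Level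
    X : Set ℓ₁
    Y : Set ℓ₂

++-≢[]ˡ : ∀ {xs : List X} ys → xs ≢ [] → xs ++ ys ≢ []
++-≢[]ˡ {xs = []}    ys xs≢[] = ⊥-elim (xs≢[] refl)
++-≢[]ˡ {xs = _ ∷ _} ys _     ()

++-≢[]ʳ : ∀ (xs : List X) {ys} → ys ≢ [] → xs ++ ys ≢ []
++-≢[]ʳ []      ys≢[] = ys≢[]
++-≢[]ʳ (_ ∷ _) _     ()

map-≢[] : ∀ (f : X → Y) {xs} → xs ≢ [] → map f xs ≢ []
map-≢[] f {[]}    xs≢[] = ⊥-elim (xs≢[] refl)
map-≢[] f {_ ∷ _} _     ()

map-++₃ : ∀ (f : X → Y) xs ys zs → map f (xs ++ ys ++ zs) ≡ map f xs ++ map f ys ++ map f zs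
map-++₃ f xs ys zs = trans (map-++ f xs _) (cong (map f xs ++_) (map-++ f ys zs))

map-++-replicate-++ : ∀ (f : X → Y) xs n x ys →
  map f (xs ++ replicate n x ++ ys) ≡ map f xs ++ replicate n (f x) ++ map f ys
map-++-replicate-++ f xs n x ys =
  trans (map-++₃ f xs (replicate n x) ys) (cong (λ zs → map f xs ++ zs ++ map f ys) (map-replicate f n x))

++-reassoc : ∀ (Φ Σ₁ Δ Σ₂ Ψ : List X) → Φ ++ (Σ₁ ++ Δ ++ Σ₂) ++ Ψ ≡ (Φ ++ Σ₁) ++ Δ ++ Σ₂ ++ Ψ
++-reassoc Φ Σ₁ Δ Σ₂ Ψ = begin
  Φ ++ (Σ₁ ++ Δ ++ Σ₂) ++ Ψ    ≡⟨ cong (Φ ++_) (++-assoc Σ₁ (Δ ++ Σ₂) Ψ) ⟩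
  Φ ++ Σ₁ ++ (Δ ++ Σ₂) ++ Ψ    ≡⟨ cong (λ Θ → Φ ++ Σ₁ ++ Θ) (++-assoc Δ Σ₂ Ψ) ⟩
  Φ ++ Σ₁ ++ Δ ++ Σ₂ ++ Ψ      ≡⟨ sym (++-assoc Φ Σ₁ _) ⟩
  (Φ ++ Σ₁) ++ Δ ++ Σ₂ ++ Ψ    ∎
  where open ≡-Reasoning

lookup-map⁺ : ∀ {P : Y → Set ℓ₃} (f : X → Y) (xs : List X) →
  (∀ i → P (f (lookup xs i))) → ∀ i → P (lookup (map f xs) i)
lookup-map⁺ f (x ∷ xs) p zero    = p zero
lookup-map⁺ {P = P} f (x ∷ xs) p (suc i) = lookup-map⁺ {P = P} f xs (λ j → p (suc j)) i

module MapAntecedent {S S′ : OpSet} (E : Fm S → Fm S′) (P : Seq S′ → Set) where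

  cast : ∀ {Π Π′ C} → Π ≡ Π′ → P (Π ⇒ C) → P (Π′ ⇒ C)
  cast refl p = p

  ⟨_⟩ : ∀ Γ {Δ C} → P (map E (Γ ++ Δ) ⇒ C) → P (map E Γ ++ map E Δ ⇒ C)
  ⟨ Γ ⟩ = cast (map-++ E Γ _)

  ⟨_⟩⁻¹ : ∀ Γ {Δ C} → P (map E Γ ++ map E Δ ⇒ C) → P (map E (Γ ++ Δ) ⇒ C)
  ⟨ Γ ⟩⁻¹ = cast (sym (map-++ E Γ _))

-- NE is the side condition on antecedents: trivial for ⊢ω, non-emptiness for ⊢⁺.
record IsCalculus {S : OpSet} (NE : List (Fm S) → Set) (Der : List (Fm S) → Fm S → Set) : Set where
  field
    NE-[-]   : ∀ {A} → NE (A ∷ [])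
    NE-++ˡ   : ∀ {Γ} Δ → NE Γ → NE (Γ ++ Δ)
    NE-++ʳ   : ∀ Γ {Δ} → NE Δ → NE (Γ ++ Δ)
    ⊢ax      : ∀ {A} → Der (A ∷ []) A
    ⊢cut     : ∀ {Π A Γ Δ C} → Der Π A → Der (Γ ++ A ∷ Δ) C → Der (Γ ++ Π ++ Δ) C
    ⊢⊥L      : ∀ {p Γ Δ C} → Der (Γ ++ bot p ∷ Δ) C
    ⊢⊤R      : ∀ {p Π} → NE Π → Der Π (top p)
    ⊢1R      : ∀ {p} → Der [] (one p)
    ⊢1L      : ∀ {p Γ Δ C} → Der (Γ ++ Δ) C → Der (Γ ++ one p ∷ Δ) C
    ⊢·L      : ∀ {p Γ A B Δ C} → Der (Γ ++ A ∷ B ∷ Δ) C → Der (Γ ++ prod p A B ∷ Δ) C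
    ⊢·R      : ∀ {p Γ Δ A B} → Der Γ A → Der Δ B → Der (Γ ++ Δ) (prod p A B)
    ⊢under-L : ∀ {p Π A Γ B Δ C} → Der Π A → Der (Γ ++ B ∷ Δ) C → Der (Γ ++ Π ++ under p A B ∷ Δ) C
    ⊢over-L  : ∀ {p Π A Γ B Δ C} → Der Π A → Der (Γ ++ B ∷ Δ) C → Der (Γ ++ over p B A ∷ Π ++ Δ) C
    ⊢under-R : ∀ {p A Π B} → NE Π → Der (A ∷ Π) B → Der Π (under p A B)
    ⊢over-R  : ∀ {p A Π B} → NE Π → Der (Π ++ A ∷ []) B → Der Π (over p B A)
    ⊢∧L₁     : ∀ {p Γ A B Δ C} → Der (Γ ++ A ∷ Δ) C → Der (Γ ++ meet p A B ∷ Δ) C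
    ⊢∧L₂     : ∀ {p Γ A B Δ C} → Der (Γ ++ B ∷ Δ) C → Der (Γ ++ meet p A B ∷ Δ) C
    ⊢∧R      : ∀ {p Π A B} → Der Π A → Der Π B → Der Π (meet p A B)
    ⊢∨L      : ∀ {p Γ A B Δ C} → Der (Γ ++ A ∷ Δ) C → Der (Γ ++ B ∷ Δ) C → Der (Γ ++ join p A B ∷ Δ) C
    ⊢∨R₁     : ∀ {p Π A B} → Der Π A → Der Π (join p A B)
    ⊢∨R₂     : ∀ {p Π A B} → Der Π B → Der Π (join p A B)
    ⊢*L      : ∀ {p Γ A Δ C} → (∀ n → Der (Γ ++ replicate n A ++ Δ) C) → Der (Γ ++ star p A ∷ Δ) C
    ⊢*R      : ∀ {p A} Πs → (∀ i → Der (lookup Πs i) A) → Der (concat Πs) (star p A)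
    ⊢+L      : ∀ {p Γ A Δ C} → (∀ n → Der (Γ ++ replicate (suc n) A ++ Δ) C) → Der (Γ ++ plus p A ∷ Δ) C
    ⊢+R      : ∀ {p A} Πs → Πs ≢ [] → (∀ i → Der (lookup Πs i) A) → Der (concat Πs) (plus p A)

module CanonicalModel {S S′ : OpSet} (sub : S ⊆ᵒ S′)
  {NE : List (Fm S) → Set} {Der : List (Fm S) → Fm S → Set} (calculus : IsCalculus NE Der) where

  open IsCalculus calculus

  Ctx : Set
  Ctx = List (Fm S)

  Pred : Set₁
  Pred = Ctx → Set

  E : Fm S → Fm S′
  E = emb sub

  cast : ∀ {Γ Γ′ C} → Γ ≡ Γ′ → Der Γ C → Der Γ′ C
  cast refl d = d

  ⊢under-apply : ∀ {p A B Δ Γ} → Der Δ A → Der Γ (under p A B) → Der (Δ ++ Γ) B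
  ⊢under-apply {Δ = Δ} {Γ} a f =
    cast (cong (Δ ++_) (++-identityʳ Γ)) (⊢cut {Γ = Δ} {Δ = []} f (⊢under-L {Γ = []} {Δ = []} a ⊢ax))

  ⊢over-apply : ∀ {p A B Γ Δ} → Der Γ (over p B A) → Der Δ A → Der (Γ ++ Δ) B
  ⊢over-apply {Γ = Γ} {Δ} f a =
    cast (cong (Γ ++_) (++-identityʳ Δ)) (⊢cut {Γ = []} {Δ = Δ ++ []} f (⊢over-L {Γ = []} {Δ = []} a ⊢ax))

  ⊢∧-proj₁ : ∀ {p A B Γ} → Der Γ (meet p A B) → Der Γ A
  ⊢∧-proj₁ {Γ = Γ} d = cast (++-identityʳ Γ) (⊢cut {Γ = []} {Δ = []} d (⊢∧L₁ {Γ = []} {Δ = []} ⊢ax))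

  ⊢∧-proj₂ : ∀ {p A B Γ} → Der Γ (meet p A B) → Der Γ B
  ⊢∧-proj₂ {Γ = Γ} d = cast (++-identityʳ Γ) (⊢cut {Γ = []} {Δ = []} d (⊢∧L₂ {Γ = []} {Δ = []} ⊢ax))

  Cl : Pred → Pred
  Cl X Γ = NE Γ × (∀ Φ Ψ D → (∀ Δ → X Δ → Der (Φ ++ Δ ++ Ψ) D) → Der (Φ ++ Γ ++ Ψ) D)

  Closed : Pred → Set
  Closed Z = ∀ {Γ} → Cl Z Γ → Z Γ

  _⊗_ : Pred → Pred → Pred
  (X ⊗ Y) Γ = Σ Ctx λ Γ₁ → Σ Ctx λ Γ₂ → Γ ≡ Γ₁ ++ Γ₂ × X Γ₁ × Y Γ₂

  _^_ : Pred → ℕ → Pred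
  (X ^ zero) Γ = Γ ≡ []
  X ^ suc n = X ⊗ (X ^ n)

  ⟦_⟧ : Fm S′ → Pred
  ⟦ var x ⟧ Γ       = NE Γ × Der Γ (var x)
  ⟦ under p A B ⟧ Γ = NE Γ × (∀ Δ → ⟦ A ⟧ Δ → ⟦ B ⟧ (Δ ++ Γ))
  ⟦ over p B A ⟧ Γ  = NE Γ × (∀ Δ → ⟦ A ⟧ Δ → ⟦ B ⟧ (Γ ++ Δ))
  ⟦ prod p A B ⟧    = Cl (⟦ A ⟧ ⊗ ⟦ B ⟧)
  ⟦ meet p A B ⟧ Γ  = ⟦ A ⟧ Γ × ⟦ B ⟧ Γ
  ⟦ join p A B ⟧    = Cl (λ Γ → ⟦ A ⟧ Γ ⊎ ⟦ B ⟧ Γ)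
  ⟦ star p A ⟧      = Cl (λ Γ → ∃ λ n → (⟦ A ⟧ ^ n) Γ)
  ⟦ plus p A ⟧      = Cl (λ Γ → ∃ λ n → (⟦ A ⟧ ^ suc n) Γ)
  ⟦ top p ⟧         = NE
  ⟦ bot p ⟧         = Cl (λ _ → ⊥)
  ⟦ one p ⟧         = Cl (_≡ [])

  Cl-closed : ∀ {X} → Closed (Cl X)
  Cl-closed (ne , c) = ne , λ Φ Ψ D k → c Φ Ψ D (λ Δ x → proj₂ x Φ Ψ D k)

  Cl-mono : ∀ {X Y : Pred} → (∀ {Δ} → X Δ → Y Δ) → ∀ {Γ} → Cl X Γ → Cl Y Γ
  Cl-mono f (ne , c) = ne , λ Φ Ψ D k → c Φ Ψ D (λ Δ x → k Δ (f x))

  Cl-unit : ∀ {X : Pred} {Γ} → NE Γ → X Γ → Cl X Γ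
  Cl-unit {Γ = Γ} ne x = ne , λ Φ Ψ D k → k Γ x

  Cl⇒Der : ∀ {X : Pred} {C} → (∀ {Δ} → X Δ → Der Δ C) → ∀ {Γ} → Cl X Γ → Der Γ C
  Cl⇒Der {C = C} f {Γ} (_ , c) =
    cast (++-identityʳ Γ) (c [] [] C (λ Δ x → cast (sym (++-identityʳ Δ)) (f x)))

  Der⇒Cl : ∀ {X : Pred} {Γ C} → NE Γ → Der Γ C →
    (∀ {Φ Ψ D} → (∀ Δ → X Δ → Der (Φ ++ Δ ++ Ψ) D) → Der (Φ ++ C ∷ Ψ) D) → Cl X Γ
  Der⇒Cl ne d left = ne , λ Φ Ψ D k → ⊢cut {Γ = Φ} d (left {Φ} {Ψ} k)

  Cl-elim : ∀ {X Z : Pred} Σ₁ Σ₂ → Closed Z → (∀ Δ → X Δ → Z (Σ₁ ++ Δ ++ Σ₂)) →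
    ∀ {Θ} → Cl X Θ → Z (Σ₁ ++ Θ ++ Σ₂)
  Cl-elim Σ₁ Σ₂ closed f {Θ} (ne , c) = closed (NE-++ʳ Σ₁ (NE-++ˡ Σ₂ ne) , λ Φ Ψ D k →
    cast (sym (++-reassoc Φ Σ₁ Θ Σ₂ Ψ))
      (c (Φ ++ Σ₁) (Σ₂ ++ Ψ) D (λ Δ x → cast (++-reassoc Φ Σ₁ Δ Σ₂ Ψ) (k _ (f Δ x)))))

  ⟦⟧-closed : ∀ C → Closed ⟦ C ⟧
  ⟦⟧-closed (var x) c = proj₁ c , Cl⇒Der proj₂ c
  ⟦⟧-closed (under p A B) {Γ} c = proj₁ c , λ Δ a →
    subst ⟦ B ⟧ (cong (Δ ++_) (++-identityʳ Γ))
      (Cl-elim Δ [] (⟦⟧-closed B)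
        (λ Γ′ f → subst ⟦ B ⟧ (cong (Δ ++_) (sym (++-identityʳ Γ′))) (proj₂ f Δ a)) c)
  ⟦⟧-closed (over p B A) c = proj₁ c , λ Δ a → Cl-elim [] Δ (⟦⟧-closed B) (λ Γ′ f → proj₂ f Δ a) c
  ⟦⟧-closed (prod p A B) = Cl-closed
  ⟦⟧-closed (meet p A B) c = ⟦⟧-closed A (Cl-mono proj₁ c) , ⟦⟧-closed B (Cl-mono proj₂ c)
  ⟦⟧-closed (join p A B) = Cl-closed
  ⟦⟧-closed (star p A)   = Cl-closed
  ⟦⟧-closed (plus p A)   = Cl-closed
  ⟦⟧-closed (top p)      = proj₁
  ⟦⟧-closed (bot p)      = Cl-closed
  ⟦⟧-closed (one p)      = Cl-closed

  ⟦⟧⇒NE : ∀ C {Γ} → ⟦ C ⟧ Γ → NE Γ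
  ⟦⟧⇒NE (var x)       = proj₁
  ⟦⟧⇒NE (under p A B) = proj₁
  ⟦⟧⇒NE (over p B A)  = proj₁
  ⟦⟧⇒NE (prod p A B)  = proj₁
  ⟦⟧⇒NE (meet p A B)  = ⟦⟧⇒NE A ∘ proj₁
  ⟦⟧⇒NE (join p A B)  = proj₁
  ⟦⟧⇒NE (star p A)    = proj₁
  ⟦⟧⇒NE (plus p A)    = proj₁
  ⟦⟧⇒NE (top p) ne    = ne
  ⟦⟧⇒NE (bot p)       = proj₁
  ⟦⟧⇒NE (one p)       = proj₁

  Sat : List (Fm S′) → Pred
  Sat []      Γ = Γ ≡ []
  Sat (A ∷ Π)   = ⟦ A ⟧ ⊗ Sat Π

  Sat⇒NE : List (Fm S′) → Set
  Sat⇒NE Π = ∀ {Γ} → Sat Π Γ → NE Γ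

  ≢[]⇒Sat⇒NE : ∀ Π → Π ≢ [] → Sat⇒NE Π
  ≢[]⇒Sat⇒NE []      Π≢[] _                       = ⊥-elim (Π≢[] refl)
  ≢[]⇒Sat⇒NE (A ∷ Π) _    (_ , Γ₂ , refl , a , _) = NE-++ˡ Γ₂ (⟦⟧⇒NE A a)

  Sat-++⁻ : ∀ Π₁ {Π₂ Γ} → Sat (Π₁ ++ Π₂) Γ → (Sat Π₁ ⊗ Sat Π₂) Γ
  Sat-++⁻ []       {Γ = Γ} s = [] , Γ , refl , refl , s
  Sat-++⁻ (A ∷ Π₁) (Γ₁ , _ , refl , a , s) with Sat-++⁻ Π₁ s
  ... | Γ₂ , Γ₃ , refl , s₁ , s₂ = Γ₁ ++ Γ₂ , Γ₃ , sym (++-assoc Γ₁ Γ₂ Γ₃) , (Γ₁ , Γ₂ , refl , a , s₁) , s₂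

  Sat-++⁺ : ∀ Π₁ {Π₂ Γ₁ Γ₂} → Sat Π₁ Γ₁ → Sat Π₂ Γ₂ → Sat (Π₁ ++ Π₂) (Γ₁ ++ Γ₂)
  Sat-++⁺ []       refl s = s
  Sat-++⁺ (A ∷ Π₁) {Γ₂ = Γ₂} (Γ₃ , Γ₄ , refl , a , s) s′ =
    Γ₃ , Γ₄ ++ Γ₂ , ++-assoc Γ₃ Γ₄ Γ₂ , a , Sat-++⁺ Π₁ s s′

  Sat-focus⁻ : ∀ Γs {A Δs Γ} → Sat (Γs ++ A ∷ Δs) Γ →
    Σ Ctx λ Σ₁ → Σ Ctx λ Θ → Σ Ctx λ Σ₂ → Γ ≡ Σ₁ ++ Θ ++ Σ₂ × Sat Γs Σ₁ × ⟦ A ⟧ Θ × Sat Δs Σ₂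
  Sat-focus⁻ Γs s with Sat-++⁻ Γs s
  ... | Σ₁ , _ , refl , s₁ , (Θ , Σ₂ , refl , a , s₂) = Σ₁ , Θ , Σ₂ , refl , s₁ , a , s₂

  Sat-focus⁺ : ∀ Γs {A Δs Σ₁ Θ Σ₂} → Sat Γs Σ₁ → ⟦ A ⟧ Θ → Sat Δs Σ₂ → Sat (Γs ++ A ∷ Δs) (Σ₁ ++ Θ ++ Σ₂)
  Sat-focus⁺ Γs s₁ a s₂ = Sat-++⁺ Γs s₁ (_ , _ , refl , a , s₂)

  ^⇒Sat-replicate : ∀ {A} n {Γ} → (⟦ A ⟧ ^ n) Γ → Sat (replicate n A) Γ
  ^⇒Sat-replicate zero    as = as
  ^⇒Sat-replicate (suc n) (Γ₁ , Γ₂ , eq , a , as) = Γ₁ , Γ₂ , eq , a , ^⇒Sat-replicate n as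

  infix 3 _⊨_
  record _⊨_ (Π : List (Fm S′)) (C : Fm S′) : Set where
    constructor mk⊨
    field apply : ∀ Γ → Sat Π Γ → ⟦ C ⟧ Γ
  open _⊨_

  ⊨ax : ∀ {A} → A ∷ [] ⊨ A
  apply (⊨ax {A}) _ (Γ , _ , refl , a , refl) = subst ⟦ A ⟧ (sym (++-identityʳ Γ)) a

  ⊨cut : ∀ Γs Πs Δs {A C} → Πs ⊨ A → Γs ++ A ∷ Δs ⊨ C → Γs ++ Πs ++ Δs ⊨ C
  apply (⊨cut Γs Πs Δs vA vC) Γ s with Sat-++⁻ Γs s
  ... | Σ₁ , _ , refl , s₁ , r with Sat-++⁻ Πs r
  ... | ΣΠ , Σ₂ , refl , sΠ , s₂ = apply vC _ (Sat-focus⁺ Γs s₁ (apply vA ΣΠ sΠ) s₂)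

  ⊨L-Cl : ∀ Γs Δs {A C} {X : Pred} → (∀ {Θ} → ⟦ A ⟧ Θ → Cl X Θ) →
    (∀ {Σ₁ Δ Σ₂} → Sat Γs Σ₁ → X Δ → Sat Δs Σ₂ → ⟦ C ⟧ (Σ₁ ++ Δ ++ Σ₂)) → Γs ++ A ∷ Δs ⊨ C
  apply (⊨L-Cl Γs Δs {C = C} toCl k) Γ s with Sat-focus⁻ Γs s
  ... | Σ₁ , Θ , Σ₂ , refl , s₁ , a , s₂ = Cl-elim Σ₁ Σ₂ (⟦⟧-closed C) (λ Δ x → k s₁ x s₂) (toCl a)

  ⊨⊥L : ∀ Γs Δs {p C} → Γs ++ bot p ∷ Δs ⊨ C
  ⊨⊥L Γs Δs = ⊨L-Cl Γs Δs (λ a → a) (λ _ ())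

  ⊨1L : ∀ Γs Δs {p C} → Γs ++ Δs ⊨ C → Γs ++ one p ∷ Δs ⊨ C
  ⊨1L Γs Δs v = ⊨L-Cl Γs Δs (λ a → a) λ { s₁ refl s₂ → apply v _ (Sat-++⁺ Γs s₁ s₂) }

  ⊨·L : ∀ Γs Δs {p A B C} → Γs ++ A ∷ B ∷ Δs ⊨ C → Γs ++ prod p A B ∷ Δs ⊨ C
  ⊨·L Γs Δs {C = C} v = ⊨L-Cl Γs Δs (λ a → a) λ { {Σ₁} {Σ₂ = Σ₂} s₁ (Δ₁ , Δ₂ , refl , a , b) s₂ →
    subst ⟦ C ⟧ (cong (Σ₁ ++_) (sym (++-assoc Δ₁ Δ₂ Σ₂)))
      (apply v _ (Sat-++⁺ Γs s₁ (Δ₁ , Δ₂ ++ Σ₂ , refl , a , (Δ₂ , Σ₂ , refl , b , s₂)))) }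

  ⊨∨L : ∀ Γs Δs {p A B C} → Γs ++ A ∷ Δs ⊨ C → Γs ++ B ∷ Δs ⊨ C → Γs ++ join p A B ∷ Δs ⊨ C
  ⊨∨L Γs Δs vA vB = ⊨L-Cl Γs Δs (λ a → a) λ
    { s₁ (inj₁ a) s₂ → apply vA _ (Sat-focus⁺ Γs s₁ a s₂)
    ; s₁ (inj₂ b) s₂ → apply vB _ (Sat-focus⁺ Γs s₁ b s₂) }

  ⊨*L : ∀ Γs Δs {p A C} → (∀ n → Γs ++ replicate n A ++ Δs ⊨ C) → Γs ++ star p A ∷ Δs ⊨ C
  ⊨*L Γs Δs {A = A} v = ⊨L-Cl Γs Δs (λ a → a) λ { s₁ (n , as) s₂ →
    apply (v n) _ (Sat-++⁺ Γs s₁ (Sat-++⁺ (replicate n A) (^⇒Sat-replicate n as) s₂)) }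

  ⊨+L : ∀ Γs Δs {p A C} → (∀ n → Γs ++ replicate (suc n) A ++ Δs ⊨ C) → Γs ++ plus p A ∷ Δs ⊨ C
  ⊨+L Γs Δs {A = A} v = ⊨L-Cl Γs Δs (λ a → a) λ { s₁ (n , as) s₂ →
    apply (v n) _ (Sat-++⁺ Γs s₁ (Sat-++⁺ (replicate (suc n) A) (^⇒Sat-replicate (suc n) as) s₂)) }

  ⊨⊤R : ∀ Πs {p} → Sat⇒NE Πs → Πs ⊨ top p
  apply (⊨⊤R Πs ne) _ s = ne s

  ⊨1R : NE [] → ∀ {p} → [] ⊨ one p
  apply (⊨1R ne) _ refl = Cl-unit ne refl

  ⊨·R : ∀ Γs Δs {p A B} → Γs ⊨ A → Δs ⊨ B → Γs ++ Δs ⊨ prod p A B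
  apply (⊨·R Γs Δs {A = A} vA vB) Γ s with Sat-++⁻ Γs s
  ... | Σ₁ , Σ₂ , refl , s₁ , s₂ =
    Cl-unit (NE-++ˡ Σ₂ (⟦⟧⇒NE A a)) (Σ₁ , Σ₂ , refl , a , apply vB Σ₂ s₂)
    where
    a : ⟦ A ⟧ Σ₁
    a = apply vA Σ₁ s₁

  ⊨under-L : ∀ Γs Πs Δs {p A B C} → Πs ⊨ A → Γs ++ B ∷ Δs ⊨ C → Γs ++ Πs ++ under p A B ∷ Δs ⊨ C
  apply (⊨under-L Γs Πs Δs {C = C} vA vC) Γ s with Sat-++⁻ Γs s
  ... | Σ₁ , _ , refl , s₁ , r with Sat-++⁻ Πs r
  ... | ΣΠ , _ , refl , sΠ , (Θ , Σ₂ , refl , f , s₂) =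
    subst ⟦ C ⟧ (cong (Σ₁ ++_) (++-assoc ΣΠ Θ Σ₂))
      (apply vC _ (Sat-focus⁺ Γs s₁ (proj₂ f ΣΠ (apply vA ΣΠ sΠ)) s₂))

  ⊨over-L : ∀ Γs Πs Δs {p A B C} → Πs ⊨ A → Γs ++ B ∷ Δs ⊨ C → Γs ++ over p B A ∷ Πs ++ Δs ⊨ C
  apply (⊨over-L Γs Πs Δs {C = C} vA vC) Γ s with Sat-++⁻ Γs s
  ... | Σ₁ , _ , refl , s₁ , (Θ , r , refl , f , r′) with Sat-++⁻ Πs r′
  ... | ΣΠ , Σ₂ , refl , sΠ , s₂ =
    subst ⟦ C ⟧ (cong (Σ₁ ++_) (++-assoc Θ ΣΠ Σ₂))
      (apply vC _ (Sat-focus⁺ Γs s₁ (proj₂ f ΣΠ (apply vA ΣΠ sΠ)) s₂))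

  ⊨under-R : ∀ Πs {p A B} → Sat⇒NE Πs → A ∷ Πs ⊨ B → Πs ⊨ under p A B
  apply (⊨under-R Πs ne v) Γ s = ne s , λ Δ a → apply v (Δ ++ Γ) (Δ , Γ , refl , a , s)

  ⊨over-R : ∀ Πs {p A B} → Sat⇒NE Πs → Πs ++ A ∷ [] ⊨ B → Πs ⊨ over p B A
  apply (⊨over-R Πs ne v) Γ s =
    ne s , λ Δ a → apply v (Γ ++ Δ) (Sat-++⁺ Πs s (Δ , [] , sym (++-identityʳ Δ) , a , refl))

  ⊨∧L₁ : ∀ Γs Δs {p A B C} → Γs ++ A ∷ Δs ⊨ C → Γs ++ meet p A B ∷ Δs ⊨ C
  apply (⊨∧L₁ Γs Δs v) Γ s with Sat-focus⁻ Γs s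
  ... | _ , _ , _ , refl , s₁ , (a , _) , s₂ = apply v _ (Sat-focus⁺ Γs s₁ a s₂)

  ⊨∧L₂ : ∀ Γs Δs {p A B C} → Γs ++ B ∷ Δs ⊨ C → Γs ++ meet p A B ∷ Δs ⊨ C
  apply (⊨∧L₂ Γs Δs v) Γ s with Sat-focus⁻ Γs s
  ... | _ , _ , _ , refl , s₁ , (_ , b) , s₂ = apply v _ (Sat-focus⁺ Γs s₁ b s₂)

  ⊨∧R : ∀ Πs {p A B} → Πs ⊨ A → Πs ⊨ B → Πs ⊨ meet p A B
  apply (⊨∧R Πs vA vB) Γ s = apply vA Γ s , apply vB Γ s

  ⊨∨R₁ : ∀ Πs {p A B} → Πs ⊨ A → Πs ⊨ join p A B
  apply (⊨∨R₁ Πs {A = A} v) Γ s = Cl-unit (⟦⟧⇒NE A a) (inj₁ a)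
    where
    a : ⟦ A ⟧ Γ
    a = apply v Γ s

  ⊨∨R₂ : ∀ Πs {p A B} → Πs ⊨ B → Πs ⊨ join p A B
  apply (⊨∨R₂ Πs {B = B} v) Γ s = Cl-unit (⟦⟧⇒NE B b) (inj₂ b)
    where
    b : ⟦ B ⟧ Γ
    b = apply v Γ s

  Sat-concat⇒^ : ∀ {A} Πs → (∀ i → lookup Πs i ⊨ A) → ∀ {Γ} → Sat (concat Πs) Γ → (⟦ A ⟧ ^ length Πs) Γ
  Sat-concat⇒^ []       v s = s
  Sat-concat⇒^ (Π ∷ Πs) v s with Sat-++⁻ Π s
  ... | Σ₁ , Σ₂ , refl , s₁ , s₂ = Σ₁ , Σ₂ , refl , apply (v zero) Σ₁ s₁ , Sat-concat⇒^ Πs (v ∘ suc) s₂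

  ⊨*R : ∀ Πs {p A} → Sat⇒NE (concat Πs) → (∀ i → lookup Πs i ⊨ A) → concat Πs ⊨ star p A
  apply (⊨*R Πs ne v) Γ s = Cl-unit (ne s) (length Πs , Sat-concat⇒^ Πs v s)

  ⊨+R : ∀ Πs {p A} → Πs ≢ [] → (∀ i → lookup Πs i ⊨ A) → concat Πs ⊨ plus p A
  ⊨+R []       Πs≢[] _ = ⊥-elim (Πs≢[] refl)
  apply (⊨+R (Π ∷ Πs) {A = A} _ v) Γ s with Sat-concat⇒^ (Π ∷ Πs) v s
  ... | Σ₁ , Σ₂ , refl , a , as = Cl-unit (NE-++ˡ Σ₂ (⟦⟧⇒NE A a)) (length Πs , Σ₁ , Σ₂ , refl , a , as)

  ^⇒concat : ∀ {X : Pred} n {Δ} → (X ^ n) Δ →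
    Σ (List Ctx) λ Πs → concat Πs ≡ Δ × length Πs ≡ n × (∀ i → X (lookup Πs i))
  ^⇒concat zero    refl = [] , refl , refl , λ ()
  ^⇒concat (suc n) (Δ₁ , _ , refl , x , xs) with ^⇒concat n xs
  ... | Πs , refl , refl , xs′ = Δ₁ ∷ Πs , refl , refl , λ { zero → x ; (suc i) → xs′ i }

  replicate-^ : ∀ {X : Pred} {A} → X (A ∷ []) → ∀ n → (X ^ n) (replicate n A)
  replicate-^ x zero    = refl
  replicate-^ x (suc n) = _ , _ , refl , x , replicate-^ x n

  ⊢*R-^ : ∀ {X : Pred} {p A} → (∀ {Δ} → X Δ → Der Δ A) → ∀ n {Δ} → (X ^ n) Δ → Der Δ (star p A)
  ⊢*R-^ toDer n xs with ^⇒concat n xs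
  ... | Πs , refl , _ , xs′ = ⊢*R Πs (toDer ∘ xs′)

  ⊢+R-^ : ∀ {X : Pred} {p A} → (∀ {Δ} → X Δ → Der Δ A) → ∀ n {Δ} → (X ^ suc n) Δ → Der Δ (plus p A)
  ⊢+R-^ toDer n xs with ^⇒concat (suc n) xs
  ... | Π ∷ Πs , refl , _ , xs′ = ⊢+R (Π ∷ Πs) (λ ()) (toDer ∘ xs′)

  ⟦E⟧⇒Der : ∀ A {Γ} → ⟦ E A ⟧ Γ → Der Γ A
  Der⇒⟦E⟧ : ∀ A {Γ} → NE Γ → Der Γ A → ⟦ E A ⟧ Γ

  ⟦E⟧-ax : ∀ A → ⟦ E A ⟧ (A ∷ [])
  ⟦E⟧-ax A = Der⇒⟦E⟧ A NE-[-] ⊢ax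

  ⟦E⟧⇒Der (var x)       = proj₂
  ⟦E⟧⇒Der (under p A B) (ne , f) = ⊢under-R ne (⟦E⟧⇒Der B (f (A ∷ []) (⟦E⟧-ax A)))
  ⟦E⟧⇒Der (over p B A)  (ne , f) = ⊢over-R ne (⟦E⟧⇒Der B (f (A ∷ []) (⟦E⟧-ax A)))
  ⟦E⟧⇒Der (prod p A B)  = Cl⇒Der λ { (_ , _ , refl , a , b) → ⊢·R (⟦E⟧⇒Der A a) (⟦E⟧⇒Der B b) }
  ⟦E⟧⇒Der (meet p A B)  (a , b) = ⊢∧R (⟦E⟧⇒Der A a) (⟦E⟧⇒Der B b)
  ⟦E⟧⇒Der (join p A B)  = Cl⇒Der λ { (inj₁ a) → ⊢∨R₁ (⟦E⟧⇒Der A a) ; (inj₂ b) → ⊢∨R₂ (⟦E⟧⇒Der B b) }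
  ⟦E⟧⇒Der (star p A)    = Cl⇒Der λ { (n , as) → ⊢*R-^ (⟦E⟧⇒Der A) n as }
  ⟦E⟧⇒Der (plus p A)    = Cl⇒Der λ { (n , as) → ⊢+R-^ (⟦E⟧⇒Der A) n as }
  ⟦E⟧⇒Der (top p)       = ⊢⊤R
  ⟦E⟧⇒Der (bot p)       = Cl⇒Der λ ()
  ⟦E⟧⇒Der (one p)       = Cl⇒Der λ { refl → ⊢1R }

  Der⇒⟦E⟧ (var x)       ne d = ne , d
  Der⇒⟦E⟧ (under p A B) ne d = ne , λ Δ a → Der⇒⟦E⟧ B (NE-++ʳ Δ ne) (⊢under-apply (⟦E⟧⇒Der A a) d)
  Der⇒⟦E⟧ (over p B A)  ne d = ne , λ Δ a → Der⇒⟦E⟧ B (NE-++ˡ Δ ne) (⊢over-apply d (⟦E⟧⇒Der A a))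
  Der⇒⟦E⟧ (prod p A B)  ne d = Der⇒Cl ne d λ k → ⊢·L (k _ (_ , _ , refl , ⟦E⟧-ax A , ⟦E⟧-ax B))
  Der⇒⟦E⟧ (meet p A B)  ne d = Der⇒⟦E⟧ A ne (⊢∧-proj₁ d) , Der⇒⟦E⟧ B ne (⊢∧-proj₂ d)
  Der⇒⟦E⟧ (join p A B)  ne d = Der⇒Cl ne d λ k → ⊢∨L (k _ (inj₁ (⟦E⟧-ax A))) (k _ (inj₂ (⟦E⟧-ax B)))
  Der⇒⟦E⟧ (star p A)    ne d = Der⇒Cl ne d λ k → ⊢*L λ n → k _ (n , replicate-^ (⟦E⟧-ax A) n)
  Der⇒⟦E⟧ (plus p A)    ne d = Der⇒Cl ne d λ k → ⊢+L λ n → k _ (n , replicate-^ (⟦E⟧-ax A) (suc n))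
  Der⇒⟦E⟧ (top p)       ne d = ne
  Der⇒⟦E⟧ (bot p)       ne d = Der⇒Cl ne d λ _ → ⊢⊥L
  Der⇒⟦E⟧ (one p)       ne d = Der⇒Cl ne d λ k → ⊢1L (k [] refl)

  Sat-map-E : ∀ Π → Sat (map E Π) Π
  Sat-map-E []      = refl
  Sat-map-E (A ∷ Π) = A ∷ [] , Π , refl , ⟦E⟧-ax A , Sat-map-E Π

  cut-Sat : ∀ Γ₀ Φ {Γ D} → Der (Φ ++ Γ₀) D → Sat (map E Γ₀) Γ → Der (Φ ++ Γ) D
  cut-Sat []       Φ d refl = d
  cut-Sat (A ∷ Γ₀) Φ d (Γ₁ , Γ₂ , refl , a , s) =
    cast (++-assoc Φ Γ₁ Γ₂)
      (cut-Sat Γ₀ (Φ ++ Γ₁) (cast (sym (++-assoc Φ Γ₁ Γ₀)) (⊢cut {Γ = Φ} (⟦E⟧⇒Der A a) d)) s)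

  ⊨hyp : ∀ Γ₀ D₀ → Sat⇒NE (map E Γ₀) → Der Γ₀ D₀ → map E Γ₀ ⊨ E D₀
  apply (⊨hyp Γ₀ D₀ ne d) Γ s = Der⇒⟦E⟧ D₀ (ne s) (cut-Sat Γ₀ [] d s)

  ⊨⇒Der : ∀ {Π C} → map E Π ⊨ E C → Der Π C
  ⊨⇒Der {Π} {C} v = ⟦E⟧⇒Der C (apply v Π (Sat-map-E Π))

module _ {S S′ : OpSet} (sub : S ⊆ᵒ S′) {H : Seq S → Set} where
  private
    E : Fm S → Fm S′
    E = emb sub

  open MapAntecedent E (Img sub H ⊢ω_)

  emb-⊢ω : ∀ {Π C} → H ⊢ω (Π ⇒ C) → Img sub H ⊢ω (map E Π ⇒ E C)
  emb-⊢ω (hyp h) = hyp (_ , h , refl)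
  emb-⊢ω ax = ax
  emb-⊢ω (⊥L {Γ = Γ}) = ⟨ Γ ⟩⁻¹ ⊥L
  emb-⊢ω ⊤R = ⊤R
  emb-⊢ω 1R = 1R
  emb-⊢ω (1L {Γ = Γ} d) = ⟨ Γ ⟩⁻¹ (1L (⟨ Γ ⟩ (emb-⊢ω d)))
  emb-⊢ω (·L {Γ = Γ} d) = ⟨ Γ ⟩⁻¹ (·L (⟨ Γ ⟩ (emb-⊢ω d)))
  emb-⊢ω (·R {Γ = Γ} d e) = ⟨ Γ ⟩⁻¹ (·R (emb-⊢ω d) (emb-⊢ω e))
  emb-⊢ω (under-L {Π = Π} {Γ = Γ} {Δ = Δ} d e) =
    cast (sym (map-++₃ E Γ Π (_ ∷ Δ))) (under-L (emb-⊢ω d) (⟨ Γ ⟩ (emb-⊢ω e)))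
  emb-⊢ω (over-L {Π = Π} {Γ = Γ} {Δ = Δ} d e) =
    cast (sym (map-++₃ E Γ (_ ∷ Π) Δ)) (over-L (emb-⊢ω d) (⟨ Γ ⟩ (emb-⊢ω e)))
  emb-⊢ω (under-R d) = under-R (emb-⊢ω d)
  emb-⊢ω (over-R {Π = Π} d) = over-R (⟨ Π ⟩ (emb-⊢ω d))
  emb-⊢ω (∧L₁ {Γ = Γ} d) = ⟨ Γ ⟩⁻¹ (∧L₁ (⟨ Γ ⟩ (emb-⊢ω d)))
  emb-⊢ω (∧L₂ {Γ = Γ} d) = ⟨ Γ ⟩⁻¹ (∧L₂ (⟨ Γ ⟩ (emb-⊢ω d)))
  emb-⊢ω (∧R d e) = ∧R (emb-⊢ω d) (emb-⊢ω e)
  emb-⊢ω (∨L {Γ = Γ} d e) = ⟨ Γ ⟩⁻¹ (∨L (⟨ Γ ⟩ (emb-⊢ω d)) (⟨ Γ ⟩ (emb-⊢ω e)))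
  emb-⊢ω (∨R₁ d) = ∨R₁ (emb-⊢ω d)
  emb-⊢ω (∨R₂ d) = ∨R₂ (emb-⊢ω d)
  emb-⊢ω (cut {Π = Π} {Γ = Γ} {Δ = Δ} d e) =
    cast (sym (map-++₃ E Γ Π Δ)) (cut (emb-⊢ω d) (⟨ Γ ⟩ (emb-⊢ω e)))
  emb-⊢ω (*L {Γ = Γ} {A = A} {Δ = Δ} ds) =
    ⟨ Γ ⟩⁻¹ (*L λ n → cast (map-++-replicate-++ E Γ n A Δ) (emb-⊢ω (ds n)))
  emb-⊢ω (*R {A = A} Πs ds) = cast (concat-map Πs) (*R (map (map E) Πs)
    (lookup-map⁺ {P = λ Π → Img sub H ⊢ω (Π ⇒ E A)} (map E) Πs (λ i → emb-⊢ω (ds i))))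

module _ {S S′ : OpSet} (sub : S ⊆ᵒ S′) {H : Seq S → Set} where
  private
    E : Fm S → Fm S′
    E = emb sub

  open MapAntecedent E (Img sub H ⊢⁺_)

  emb-⊢⁺ : ∀ {Π C} → H ⊢⁺ (Π ⇒ C) → Img sub H ⊢⁺ (map E Π ⇒ E C)
  emb-⊢⁺ (hyp h) = hyp (_ , h , refl)
  emb-⊢⁺ ax = ax
  emb-⊢⁺ (⊥L {Γ = Γ}) = ⟨ Γ ⟩⁻¹ ⊥L
  emb-⊢⁺ (⊤R ne) = ⊤R (map-≢[] E ne)
  emb-⊢⁺ (·L {Γ = Γ} d) = ⟨ Γ ⟩⁻¹ (·L (⟨ Γ ⟩ (emb-⊢⁺ d)))
  emb-⊢⁺ (·R {Γ = Γ} d e) = ⟨ Γ ⟩⁻¹ (·R (emb-⊢⁺ d) (emb-⊢⁺ e))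
  emb-⊢⁺ (under-L {Π = Π} {Γ = Γ} {Δ = Δ} d e) =
    cast (sym (map-++₃ E Γ Π (_ ∷ Δ))) (under-L (emb-⊢⁺ d) (⟨ Γ ⟩ (emb-⊢⁺ e)))
  emb-⊢⁺ (over-L {Π = Π} {Γ = Γ} {Δ = Δ} d e) =
    cast (sym (map-++₃ E Γ (_ ∷ Π) Δ)) (over-L (emb-⊢⁺ d) (⟨ Γ ⟩ (emb-⊢⁺ e)))
  emb-⊢⁺ (under-R ne d) = under-R (map-≢[] E ne) (emb-⊢⁺ d)
  emb-⊢⁺ (over-R {Π = Π} ne d) = over-R (map-≢[] E ne) (⟨ Π ⟩ (emb-⊢⁺ d))
  emb-⊢⁺ (∧L₁ {Γ = Γ} d) = ⟨ Γ ⟩⁻¹ (∧L₁ (⟨ Γ ⟩ (emb-⊢⁺ d)))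
  emb-⊢⁺ (∧L₂ {Γ = Γ} d) = ⟨ Γ ⟩⁻¹ (∧L₂ (⟨ Γ ⟩ (emb-⊢⁺ d)))
  emb-⊢⁺ (∧R d e) = ∧R (emb-⊢⁺ d) (emb-⊢⁺ e)
  emb-⊢⁺ (∨L {Γ = Γ} d e) = ⟨ Γ ⟩⁻¹ (∨L (⟨ Γ ⟩ (emb-⊢⁺ d)) (⟨ Γ ⟩ (emb-⊢⁺ e)))
  emb-⊢⁺ (∨R₁ d) = ∨R₁ (emb-⊢⁺ d)
  emb-⊢⁺ (∨R₂ d) = ∨R₂ (emb-⊢⁺ d)
  emb-⊢⁺ (cut {Π = Π} {Γ = Γ} {Δ = Δ} d e) =
    cast (sym (map-++₃ E Γ Π Δ)) (cut (emb-⊢⁺ d) (⟨ Γ ⟩ (emb-⊢⁺ e)))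
  emb-⊢⁺ (+L {Γ = Γ} {A = A} {Δ = Δ} ds) =
    ⟨ Γ ⟩⁻¹ (+L λ n → cast (map-++-replicate-++ E Γ (suc n) A Δ) (emb-⊢⁺ (ds n)))
  emb-⊢⁺ (+R {A = A} Πs ne ds) = cast (concat-map Πs) (+R (map (map E) Πs) (map-≢[] (map E) ne)
    (lookup-map⁺ {P = λ Π → Img sub H ⊢⁺ (Π ⇒ E A)} (map E) Πs (λ i → emb-⊢⁺ (ds i))))

ω-calculus : ∀ {S} {H : Seq S → Set} → ¬ T (S c+) → IsCalculus (λ _ → ⊤) (λ Γ A → H ⊢ω (Γ ⇒ A))
ω-calculus no+ = record
  { NE-[-] = tt ; NE-++ˡ = λ _ _ → tt ; NE-++ʳ = λ _ _ → tt
  ; ⊢ax = ax ; ⊢cut = cut ; ⊢⊥L = ⊥L ; ⊢⊤R = λ _ → ⊤R ; ⊢1R = 1R ; ⊢1L = 1L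
  ; ⊢·L = ·L ; ⊢·R = ·R ; ⊢under-L = under-L ; ⊢over-L = over-L
  ; ⊢under-R = λ _ → under-R ; ⊢over-R = λ _ → over-R
  ; ⊢∧L₁ = ∧L₁ ; ⊢∧L₂ = ∧L₂ ; ⊢∧R = ∧R ; ⊢∨L = ∨L ; ⊢∨R₁ = ∨R₁ ; ⊢∨R₂ = ∨R₂
  ; ⊢*L = *L ; ⊢*R = *R
  ; ⊢+L = λ {p} → ⊥-elim (no+ p) ; ⊢+R = λ {p} → ⊥-elim (no+ p)
  }

⁺-calculus : ∀ {S} {H : Seq S → Set} → ¬ T (S c*) → ¬ T (S c1) →
  IsCalculus NonEmpty (λ Γ A → H ⊢⁺ (Γ ⇒ A))
⁺-calculus no* no1 = record
  { NE-[-] = λ () ; NE-++ˡ = ++-≢[]ˡ ; NE-++ʳ = ++-≢[]ʳ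
  ; ⊢ax = ax ; ⊢cut = cut ; ⊢⊥L = ⊥L ; ⊢⊤R = ⊤R
  ; ⊢1R = λ {p} → ⊥-elim (no1 p) ; ⊢1L = λ {p} → ⊥-elim (no1 p)
  ; ⊢·L = ·L ; ⊢·R = ·R ; ⊢under-L = under-L ; ⊢over-L = over-L ; ⊢under-R = under-R ; ⊢over-R = over-R
  ; ⊢∧L₁ = ∧L₁ ; ⊢∧L₂ = ∧L₂ ; ⊢∧R = ∧R ; ⊢∨L = ∨L ; ⊢∨R₁ = ∨R₁ ; ⊢∨R₂ = ∨R₂
  ; ⊢*L = λ {p} → ⊥-elim (no* p) ; ⊢*R = λ {p} → ⊥-elim (no* p)
  ; ⊢+L = +L ; ⊢+R = +R
  }

module _ {S S′ : OpSet} (sub : S ⊆ᵒ S′) (no+ : ¬ T (S c+)) (H : Seq S → Set) where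
  open CanonicalModel sub (ω-calculus {H = H} no+)

  ⊢ω⇒⊨ : ∀ {Π C} → Img sub H ⊢ω (Π ⇒ C) → Π ⊨ C
  ⊢ω⇒⊨ (hyp ((Γ₀ ⇒ D₀) , h , refl)) = ⊨hyp Γ₀ D₀ _ (hyp h)
  ⊢ω⇒⊨ ax = ⊨ax
  ⊢ω⇒⊨ (⊥L {Γ = Γ} {Δ}) = ⊨⊥L Γ Δ
  ⊢ω⇒⊨ ⊤R = ⊨⊤R _ _
  ⊢ω⇒⊨ 1R = ⊨1R tt
  ⊢ω⇒⊨ (1L {Γ = Γ} {Δ} d) = ⊨1L Γ Δ (⊢ω⇒⊨ d)
  ⊢ω⇒⊨ (·L {Γ = Γ} {Δ = Δ} d) = ⊨·L Γ Δ (⊢ω⇒⊨ d)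
  ⊢ω⇒⊨ (·R {Γ = Γ} {Δ} d e) = ⊨·R Γ Δ (⊢ω⇒⊨ d) (⊢ω⇒⊨ e)
  ⊢ω⇒⊨ (under-L {Π = Π} {Γ = Γ} {Δ = Δ} d e) = ⊨under-L Γ Π Δ (⊢ω⇒⊨ d) (⊢ω⇒⊨ e)
  ⊢ω⇒⊨ (over-L {Π = Π} {Γ = Γ} {Δ = Δ} d e) = ⊨over-L Γ Π Δ (⊢ω⇒⊨ d) (⊢ω⇒⊨ e)
  ⊢ω⇒⊨ (under-R d) = ⊨under-R _ _ (⊢ω⇒⊨ d)
  ⊢ω⇒⊨ (over-R d) = ⊨over-R _ _ (⊢ω⇒⊨ d)
  ⊢ω⇒⊨ (∧L₁ {Γ = Γ} {Δ = Δ} d) = ⊨∧L₁ Γ Δ (⊢ω⇒⊨ d)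
  ⊢ω⇒⊨ (∧L₂ {Γ = Γ} {Δ = Δ} d) = ⊨∧L₂ Γ Δ (⊢ω⇒⊨ d)
  ⊢ω⇒⊨ (∧R d e) = ⊨∧R _ (⊢ω⇒⊨ d) (⊢ω⇒⊨ e)
  ⊢ω⇒⊨ (∨L {Γ = Γ} {Δ = Δ} d e) = ⊨∨L Γ Δ (⊢ω⇒⊨ d) (⊢ω⇒⊨ e)
  ⊢ω⇒⊨ (∨R₁ d) = ⊨∨R₁ _ (⊢ω⇒⊨ d)
  ⊢ω⇒⊨ (∨R₂ d) = ⊨∨R₂ _ (⊢ω⇒⊨ d)
  ⊢ω⇒⊨ (cut {Π = Π} {Γ = Γ} {Δ = Δ} d e) = ⊨cut Γ Π Δ (⊢ω⇒⊨ d) (⊢ω⇒⊨ e)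
  ⊢ω⇒⊨ (*L {Γ = Γ} {Δ = Δ} ds) = ⊨*L Γ Δ (⊢ω⇒⊨ ∘ ds)
  ⊢ω⇒⊨ (*R Πs ds) = ⊨*R Πs _ (⊢ω⇒⊨ ∘ ds)

  ω-conservative : ∀ Π C → (H ⊢ω (Π ⇒ C)) ⇔ (Img sub H ⊢ω (map (emb sub) Π ⇒ emb sub C))
  ω-conservative Π C = mk⇔ (emb-⊢ω sub) (⊨⇒Der ∘ ⊢ω⇒⊨)

module _ {S S′ : OpSet} (sub : S ⊆ᵒ S′) (no* : ¬ T (S c*)) (no1 : ¬ T (S c1))
  (H : Seq S → Set) (H-nonempty : ∀ Γ D → H (Γ ⇒ D) → NonEmpty Γ) where
  open CanonicalModel sub (⁺-calculus {H = H} no* no1)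

  ⊢⁺⇒⊨ : ∀ {Π C} → Img sub H ⊢⁺ (Π ⇒ C) → Π ⊨ C
  ⊢⁺⇒⊨ (hyp ((Γ₀ ⇒ D₀) , h , refl)) =
    ⊨hyp Γ₀ D₀ (≢[]⇒Sat⇒NE (map (emb sub) Γ₀) (map-≢[] (emb sub) (H-nonempty Γ₀ D₀ h))) (hyp h)
  ⊢⁺⇒⊨ ax = ⊨ax
  ⊢⁺⇒⊨ (⊥L {Γ = Γ} {Δ}) = ⊨⊥L Γ Δ
  ⊢⁺⇒⊨ (⊤R ne) = ⊨⊤R _ (≢[]⇒Sat⇒NE _ ne)
  ⊢⁺⇒⊨ (·L {Γ = Γ} {Δ = Δ} d) = ⊨·L Γ Δ (⊢⁺⇒⊨ d)
  ⊢⁺⇒⊨ (·R {Γ = Γ} {Δ} d e) = ⊨·R Γ Δ (⊢⁺⇒⊨ d) (⊢⁺⇒⊨ e)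
  ⊢⁺⇒⊨ (under-L {Π = Π} {Γ = Γ} {Δ = Δ} d e) = ⊨under-L Γ Π Δ (⊢⁺⇒⊨ d) (⊢⁺⇒⊨ e)
  ⊢⁺⇒⊨ (over-L {Π = Π} {Γ = Γ} {Δ = Δ} d e) = ⊨over-L Γ Π Δ (⊢⁺⇒⊨ d) (⊢⁺⇒⊨ e)
  ⊢⁺⇒⊨ (under-R ne d) = ⊨under-R _ (≢[]⇒Sat⇒NE _ ne) (⊢⁺⇒⊨ d)
  ⊢⁺⇒⊨ (over-R ne d) = ⊨over-R _ (≢[]⇒Sat⇒NE _ ne) (⊢⁺⇒⊨ d)
  ⊢⁺⇒⊨ (∧L₁ {Γ = Γ} {Δ = Δ} d) = ⊨∧L₁ Γ Δ (⊢⁺⇒⊨ d)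
  ⊢⁺⇒⊨ (∧L₂ {Γ = Γ} {Δ = Δ} d) = ⊨∧L₂ Γ Δ (⊢⁺⇒⊨ d)
  ⊢⁺⇒⊨ (∧R d e) = ⊨∧R _ (⊢⁺⇒⊨ d) (⊢⁺⇒⊨ e)
  ⊢⁺⇒⊨ (∨L {Γ = Γ} {Δ = Δ} d e) = ⊨∨L Γ Δ (⊢⁺⇒⊨ d) (⊢⁺⇒⊨ e)
  ⊢⁺⇒⊨ (∨R₁ d) = ⊨∨R₁ _ (⊢⁺⇒⊨ d)
  ⊢⁺⇒⊨ (∨R₂ d) = ⊨∨R₂ _ (⊢⁺⇒⊨ d)
  ⊢⁺⇒⊨ (cut {Π = Π} {Γ = Γ} {Δ = Δ} d e) = ⊨cut Γ Π Δ (⊢⁺⇒⊨ d) (⊢⁺⇒⊨ e)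
  ⊢⁺⇒⊨ (+L {Γ = Γ} {Δ = Δ} ds) = ⊨+L Γ Δ (⊢⁺⇒⊨ ∘ ds)
  ⊢⁺⇒⊨ (+R Πs ne ds) = ⊨+R Πs ne (⊢⁺⇒⊨ ∘ ds)

  ⁺-conservative : ∀ Π C → (H ⊢⁺ (Π ⇒ C)) ⇔ (Img sub H ⊢⁺ (map (emb sub) Π ⇒ emb sub C))
  ⁺-conservative Π C = mk⇔ (emb-⊢⁺ sub) (⊨⇒Der ∘ ⊢⁺⇒⊨)

corollary4 :
    ((S : OpSet) (sub : S ⊆ᵒ opsω) → T (S c·) →
      (H : Seq S → Set) (Π : List (Fm S)) (C : Fm S) →
      (H ⊢ω (Π ⇒ C)) ⇔ (Img sub H ⊢ω (map (emb sub) Π ⇒ emb sub C)))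
    ×
    ((S : OpSet) (sub : S ⊆ᵒ ops⁺) → T (S c·) →
      (H : Seq S → Set) → (∀ Γ D → H (Γ ⇒ D) → NonEmpty Γ) →
      (Π : List (Fm S)) (C : Fm S) → NonEmpty Π →
      (H ⊢⁺ (Π ⇒ C)) ⇔ (Img sub H ⊢⁺ (map (emb sub) Π ⇒ emb sub C)))
corollary4 =
  (λ S sub _ H → ω-conservative sub (sub c+) H) ,
  (λ S sub _ H H-nonempty Π C _ → ⁺-conservative sub (sub c*) (sub c1) H H-nonempty Π C)
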